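{- Let $\Phi$ be a root system with weight lattice $\Lambda$ and index set $I$ for the simple roots $(\alpha_i)_{i\in I}$, and let $\mathcal{Q}$ and $\mathcal{Q}'$ be seminormal quasi-crystals of type $\Phi$ with underlying sets $Q$ and $Q'$. Let $Q\ddot{\otimes}Q'$ be the Cartesian product $Q\times Q'$, whose elements are written $x\ddot{\otimes}x'$ ($x\in Q$, $x'\in Q'$). Define $\mathrm{wt}(x\ddot{\otimes}x')=\mathrm{wt}(x)+\mathrm{wt}(x')$, and for each $i\in I$ define $\ddot{e}_i,\ddot{f}_i:Q\ddot{\otimes}Q'\to (Q\ddot{\otimes}Q')\sqcup\{\bot\}$ and $\ddot{\varepsilon}_i,\ddot{\varphi}_i:Q\ddot{\otimes}Q'\to\mathbb{Z}\cup\{ -\infty,+\infty\}$ as follows: (1) if $\ddot{\varphi}_i(x)>0$ and $\ddot{\varepsilon}_i(x')>0$, set $\ddot{e}_i(x\ddot{\otimes}x')=\ddot{f}_i(x\ddot{\otimes}x')=\bot$ and $\ddot{\varepsilon}_i(x\ddot{\otimes}x')=\ddot{\varphi}_i(x\ddot{\otimes}x')=+\infty$; (2) otherwise set $\ddot{e}_i(x\ddot{\otimes}x')=\ddot{e}_i(x)\ddot{\otimes}x'$ if $\ddot{\varphi}_i(x)\ge\ddot{\varepsilon}_i(x')$ and $=x\ddot{\otimes}\ddot{e}_i(x')$ if $\ddot{\varphi}_i(x)<\ddot{\varepsilon}_i(x')$; $\ddot{f}_i(x\ddot{\otimes}x')=\ddot{f}_i(x)\ddot{\otimes}x'$ if $\ddot{\varphi}_i(x)>\ddot{\varepsilon}_i(x')$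 and $=x\ddot{\otimes}\ddot{f}_i(x')$ if $\ddot{\varphi}_i(x)\le\ddot{\varepsilon}_i(x')$; $\ddot{\varepsilon}_i(x\ddot{\otimes}x')=\max\{\ddot{\varepsilon}_i(x),\ \ddot{\varepsilon}_i(x')-\langle\mathrm{wt}(x),\alpha_i^\vee\rangle\}$; and $\ddot{\varphi}_i(x\ddot{\otimes}x')=\max\{\ddot{\varphi}_i(x)+\langle\mathrm{wt}(x'),\alpha_i^\vee\rangle,\ \ddot{\varphi}_i(x')\}$; where $x\ddot{\otimes}\bot=\bot\ddot{\otimes}x'=\bot$. Then $Q\ddot{\otimes}Q'$ together with $\mathrm{wt}$, $\ddot{e}_i,\ddot{f}_i,\ddot{\varepsilon}_i,\ddot{\varphi}_i$ ($i\in I$) is a seminormal quasi-crystal of type $\Phi$.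
   Context: Let $V$ be a finite-dimensional real vector space with inner product $\langle\cdot,\cdot\rangle$; for $0\ne\alpha\in V$ put $\alpha^\vee=\frac{2}{\langle\alpha,\alpha\rangle}\alpha$. A root system is a nonempty finite set $\Phi\subseteq V\setminus\{0\}$ such that $\beta-\langle\beta,\alpha^\vee\rangle\alpha\in\Phi$ and $\langle\beta,\alpha^\vee\rangle\in\mathbb{Z}$ for all $\alpha,\beta\in\Phi$, and such that $\alpha,k\alpha\in\Phi$ implies $k=\pm1$. With it one fixes an index set $I$ and simple roots $(\alpha_i)_{i\in I}$ in $\Phi$ (linearly independent, and every root is an integer combination of them with all coefficients $\ge0$ or all $\le0$), and a weight lattice $\Lambda$: a $\mathbb{Z}$-submodule of $V$ spanning $V$, containing $\Phi$, with $\langle\lambda,\alpha^\vee\rangle\in\mathbb{Z}$ for all $\lambda\in\Lambda,\alpha\in\Phi$. Extend $\mathbb{Z}$ by $-\infty<m<+\infty$ with $m+(\pm\infty)=(\pm\infty)+m=\pm\infty$ for $m\in\mathbb{Z}$. A quasi-crystal $\mathcal{Q}$ of type $\Phi$ is a set $Q$ with maps $\mathrm{wt}:Q\to\Lambda$, $\ddot{e}_i,\ddot{f}_i:Q\to Q\sqcup\{\bot\}$ ($\bot$ means "undefined") and $\ddot{\varepsilon}_i,\ddot{\varphi}_i:Q\to\mathbb{Z}\cup\{ -\infty,+\infty\}$ ($i\in I$) such that for all $x,y\in Q$, $i\in I$: (a) $\ddot{\varphi}_i(x)=\ddot{\varepsilon}_i(x)+\langle\mathrm{wt}(x),\alpha_i^\vee\rangle$;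 (b) if $\ddot{e}_i(x)\in Q$ then $\mathrm{wt}(\ddot{e}_i(x))=\mathrm{wt}(x)+\alpha_i$, $\ddot{\varepsilon}_i(\ddot{e}_i(x))=\ddot{\varepsilon}_i(x)-1$, $\ddot{\varphi}_i(\ddot{e}_i(x))=\ddot{\varphi}_i(x)+1$; (c) if $\ddot{f}_i(x)\in Q$ then $\mathrm{wt}(\ddot{f}_i(x))=\mathrm{wt}(x)-\alpha_i$, $\ddot{\varepsilon}_i(\ddot{f}_i(x))=\ddot{\varepsilon}_i(x)+1$, $\ddot{\varphi}_i(\ddot{f}_i(x))=\ddot{\varphi}_i(x)-1$; (d) $\ddot{e}_i(x)=y$ iff $x=\ddot{f}_i(y)$; (e) if $\ddot{\varepsilon}_i(x)\in\{ -\infty,+\infty\}$ then $\ddot{e}_i(x)=\ddot{f}_i(x)=\bot$. Operators are composed as partial maps, with $\ddot{e}_i^0,\ddot{f}_i^0$ the identity. $\mathcal{Q}$ is seminormal if for all $x\in Q$, $i\in I$ with $\ddot{\varepsilon}_i(x)\ne+\infty$: $\ddot{\varepsilon}_i(x)=\max\{k\ge0:\ddot{e}_i^k(x)\in Q\}$ and $\ddot{\varphi}_i(x)=\max\{k\ge0:\ddot{f}_i^k(x)\in Q\}$. -}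

module Defs where

open import Data.Bool using (Bool; true; false; if_then_else_; _∧_; not)
open import Data.Nat using (ℕ; zero; suc) renaming (_≤_ to _≤ℕ_)
open import Data.Integer as ℤ using (ℤ; +_) renaming (_+_ to _+ℤ_; -_ to -ℤ_)
open import Data.Maybe using (Maybe; just; nothing; _>>=_; is-just)
import Data.Maybe as Maybe
open import Data.Product using (_×_; _,_; ∃-syntax)
open import Data.Sum using (_⊎_)
open import Relation.Nullary using (¬_; does)
open import Relation.Binary.PropositionalEquality using (_≡_)
open import Algebra.Structures using (IsAbelianGroup)

record WeightData (I : Set) : Set₁ where
  field
    Λ      : Set
    _⊕_    : Λ → Λ → Λ
    𝟘      : Λ
    ⊖_     : Λ → Λ
    isAbelianGroup : IsAbelianGroup _≡_ _⊕_ 𝟘 ⊖_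
    α      : I → Λ
    ⟨_,_∨⟩ : Λ → I → ℤ
    pairing-+ : ∀ l μ i → ⟨ l ⊕ μ , i ∨⟩ ≡ ⟨ l , i ∨⟩ +ℤ ⟨ μ , i ∨⟩
    pairing-α : ∀ i → ⟨ α i , i ∨⟩ ≡ + 2

data ℤ∞ : Set where
  -∞  : ℤ∞
  fin : ℤ → ℤ∞
  +∞  : ℤ∞

-- m + (±∞) = ±∞ ; we only ever add a finite integer
infixl 6 _+ₑ_
_+ₑ_ : ℤ∞ → ℤ → ℤ∞
-∞     +ₑ m = -∞
fin n  +ₑ m = fin (n +ℤ m)
+∞     +ₑ m = +∞

_≤ᵇ_ : ℤ∞ → ℤ∞ → Bool
-∞    ≤ᵇ _     = true
fin _ ≤ᵇ -∞    = false
fin m ≤ᵇ fin n = does (m ℤ.≤? n)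
fin _ ≤ᵇ  +∞   = true
+∞    ≤ᵇ  +∞   = true
+∞    ≤ᵇ _     = false

_<ᵇ_ : ℤ∞ → ℤ∞ → Bool
x <ᵇ y = not (y ≤ᵇ x)

max∞ : ℤ∞ → ℤ∞ → ℤ∞
max∞ x y = if x ≤ᵇ y then y else x

iter : {Q : Set} → ℕ → (Q → Maybe Q) → Q → Maybe Q
iter zero    g x = just x
iter (suc k) g x = iter k g x >>= g

module _ {I : Set} (W : WeightData I) where
  open WeightData W

  record QCData (Q : Set) : Set where
    field
      wt : Q → Λ
      ë  : I → Q → Maybe Q      -- nothing = ⊥ (undefined)
      f̈  : I → Q → Maybe Q
      ε̈  : I → Q → ℤ∞
      φ̈  : I → Q → ℤ∞

  record IsQuasiCrystal {Q : Set} (D : QCData Q) : Set where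
    open QCData D
    field
      ax-a : ∀ (x : Q) i → φ̈ i x ≡ ε̈ i x  +ₑ ⟨ wt x , i ∨⟩
      ax-b : ∀ (x y : Q) i → ë i x ≡ just y →
               (wt y ≡ wt x ⊕ α i) × (ε̈ i y ≡ ε̈ i x  +ₑ (-ℤ (+ 1))) × (φ̈ i y ≡ φ̈ i x  +ₑ (+ 1))
      ax-c : ∀ (x y : Q) i → f̈ i x ≡ just y →
               (wt y ≡ wt x ⊕ (⊖ α i)) × (ε̈ i y ≡ ε̈ i x  +ₑ (+ 1)) × (φ̈ i y ≡ φ̈ i x  +ₑ (-ℤ (+ 1)))
      ax-d-⇒ : ∀ (x y : Q) i → ë i x ≡ just y → f̈ i y ≡ just x
      ax-d-⇐ : ∀ (x y : Q) i → f̈ i y ≡ just x → ë i x ≡ just y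
      ax-e : ∀ (x : Q) i → (ε̈ i x ≡ -∞ ⊎ ε̈ i x ≡ +∞) →
               (ë i x ≡ nothing) × (f̈ i x ≡ nothing)

  IsMaxDefined : {Q : Set} → (Q → Maybe Q) → Q → ℤ∞ → Set
  IsMaxDefined g x v =
    ∃[ k ] (v ≡ fin (+ k)) × (is-just (iter k g x) ≡ true)
           × (∀ m → is-just (iter m g x) ≡ true → m ≤ℕ k)

  record IsSeminormal {Q : Set} (D : QCData Q) : Set where
    open QCData D
    field
      sn-ε : ∀ (x : Q) i → ¬ (ε̈ i x ≡ +∞) → IsMaxDefined (ë i) x (ε̈ i x)
      sn-φ : ∀ (x : Q) i → ¬ (ε̈ i x ≡ +∞) → IsMaxDefined (f̈ i) x (φ̈ i x)

  tensor : {Q Q' : Set} → QCData Q → QCData Q' → QCData (Q × Q')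
  tensor {Q} {Q'} D D' = record
    { wt = λ { (x , x') → wt x ⊕ wt' x' }
    ; ë  = λ i → λ { (x , x') → if case1 i x x' then nothing
                     else (if ε̈' i x' ≤ᵇ φ̈ i x
                           then Maybe.map (λ y → y , x') (ë i x)
                           else Maybe.map (λ y' → x , y') (ë' i x')) }
    ; f̈  = λ i → λ { (x , x') → if case1 i x x' then nothing
                     else (if ε̈' i x' <ᵇ φ̈ i x
                           then Maybe.map (λ y → y , x') (f̈ i x)
                           else Maybe.map (λ y' → x , y') (f̈' i x')) }
    ; ε̈  = λ i → λ { (x , x') → if case1 i x x' then +∞
                     else max∞ (ε̈ i x) (ε̈' i x'  +ₑ (-ℤ ⟨ wt x , i ∨⟩)) }
    ; φ̈  = λ i → λ { (x , x') → if case1 i x x' then +∞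
                     else max∞ (φ̈ i x  +ₑ ⟨ wt' x' , i ∨⟩) (φ̈' i x') }
    }
    where
      open QCData D
      open QCData D' renaming (wt to wt'; ë to ë'; f̈ to f̈'; ε̈ to ε̈'; φ̈ to φ̈')
      case1 : I → Q → Q' → Bool
      case1 i x x' = (fin (+ 0) <ᵇ φ̈ i x) ∧ (fin (+ 0) <ᵇ ε̈' i x')

module Submission where

-- In a seminormal quasi-crystal each x is, for each i, either unbounded (ε̈ᵢ x = φ̈ᵢ x = +∞,
-- ëᵢ and f̈ᵢ undefined at x) or bounded: ε̈ᵢ x = a and φ̈ᵢ x = b are natural numbers with
-- b = a + ⟨wt x, αᵢ^∨⟩, ëᵢ is defined at x iff a > 0 and f̈ᵢ iff b > 0. Conversely, if every
-- element has such a status and ëᵢ, f̈ᵢ lower ε̈ᵢ, φ̈ᵢ by one, then (a), (e) and seminormality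
-- hold, because ε̈ᵢ and φ̈ᵢ count the remaining steps.
-- An element x ⊗̈ x' in case (1), or with an unbounded factor, is unbounded. Otherwise both
-- factors are bounded with φ̈ᵢ x = 0 or ε̈ᵢ x' = 0; the maxima then collapse to
-- ε̈ᵢ = ε̈ᵢ x + ε̈ᵢ x' and φ̈ᵢ = φ̈ᵢ x + φ̈ᵢ x', ëᵢ acts on x iff ε̈ᵢ x' = 0, f̈ᵢ acts on x iff
-- φ̈ᵢ x > 0, and every ëᵢ- or f̈ᵢ-step stays in this situation.

open import Defs
open import Algebra.Bundles using (CommutativeSemigroup)
open import Algebra.Structures using (IsAbelianGroup)
import Algebra.Properties.CommutativeSemigroup as CommutativeSemigroupProperties
open import Data.Bool using (true; false; _∧_)
open import Data.Bool.Properties using (∧-zeroʳ)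
open import Data.Empty using (⊥-elim)
open import Data.Integer as ℤ using (ℤ; +_; _⊔_) renaming (_+_ to _+ℤ_; -_ to -ℤ_; _-_ to _-ℤ_)
import Data.Integer.Properties as ℤ
open import Data.Integer.Tactic.RingSolver using (solve-∀)
open import Data.Maybe using (Maybe; just; nothing; _>>=_; is-just)
import Data.Maybe as Maybe
open import Data.Maybe.Properties using (just-injective)
open import Data.Nat using (ℕ; zero; suc; z≤n; s≤s) renaming (_+_ to _+ℕ_; _≤_ to _≤ℕ_)
import Data.Nat.Properties as ℕ
open import Data.Product using (_×_; _,_; proj₁; proj₂)
open import Data.Sum using (_⊎_; inj₁; inj₂)
open import Relation.Nullary using (¬_; Dec; yes; no)
open import Relation.Binary.PropositionalEquality

data Step {X : Set} (g : X → Maybe X) (x : X) : ℕ → Set where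
  stop : g x ≡ nothing → Step g x 0
  step : ∀ {n} y → g x ≡ just y → Step g x (suc n)

iter-suc : ∀ {X : Set} k (g : X → Maybe X) x → iter (suc k) g x ≡ (g x >>= iter k g)
iter-suc zero    g x with g x
... | just _  = refl
... | nothing = refl
iter-suc (suc k) g x = trans (cong (_>>= g) (iter-suc k g x)) (>>=-assoc (g x))
  where
    >>=-assoc : ∀ m → ((m >>= iter k g) >>= g) ≡ (m >>= λ y → iter k g y >>= g)
    >>=-assoc nothing  = refl
    >>=-assoc (just _) = refl

iter-stop : ∀ {X : Set} {g : X → Maybe X} {x} → g x ≡ nothing → ∀ k → iter (suc k) g x ≡ nothing
iter-stop {g = g} {x} g⊥ k = trans (iter-suc k g x) (cong (_>>= iter k g) g⊥)

iter-step : ∀ {X : Set} {g : X → Maybe X} {x y} → g x ≡ just y → ∀ k → iter (suc k) g x ≡ iter k g y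
iter-step {g = g} {x} gy k = trans (iter-suc k g x) (cong (_>>= iter k g) gy)

trans-map : ∀ {A B : Set} {h : A → B} {m : Maybe B} {n r : Maybe A} →
            m ≡ Maybe.map h n → n ≡ r → m ≡ Maybe.map h r
trans-map eq refl = eq

is+∞? : (v : ℤ∞) → Dec (v ≡ +∞)
is+∞? -∞      = no λ ()
is+∞? (fin _) = no λ ()
is+∞? +∞      = yes refl

fin-injective : ∀ {m n} → fin m ≡ fin n → m ≡ n
fin-injective refl = refl

fin≢+∞ : ∀ {v m} → v ≡ fin m → ¬ v ≡ +∞
fin≢+∞ refl ()

fin-suc : ∀ n → fin (+ n) +ₑ + 1 ≡ fin (+ suc n)
fin-suc n = cong (λ k → fin (+ k)) (ℕ.+-comm n 1)

pred-fin : ∀ {u v : ℤ∞} {m n} → u ≡ fin (+ m) → m ≡ suc n → v ≡ fin (+ n) → v ≡ u +ₑ -ℤ (+ 1)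
pred-fin refl refl refl = refl

suc-fin : ∀ {u v : ℤ∞} {m n} → u ≡ fin (+ m) → n ≡ suc m → v ≡ fin (+ n) → v ≡ u +ₑ + 1
suc-fin {m = m} refl refl refl = sym (fin-suc m)

max∞-fin : ∀ m n → max∞ (fin m) (fin n) ≡ fin (m ⊔ n)
max∞-fin m n with m ℤ.≤? n
... | yes m≤n = cong fin (sym (ℤ.i≤j⇒i⊔j≡j m≤n))
... | no  m≰n = cong fin (sym (ℤ.i≥j⇒i⊔j≡i (ℤ.<⇒≤ (ℤ.≰⇒> m≰n))))

m≡n+w⇒w≡m-n : ∀ {m} n w → m ≡ n +ℤ w → w ≡ m -ℤ n
m≡n+w⇒w≡m-n n w eq = trans (identity n w) (cong (λ t → t -ℤ n) (sym eq))
  where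
    identity : ∀ n w → w ≡ (n +ℤ w) -ℤ n
    identity = solve-∀

m≡n+w⇒-w≡n-m : ∀ {m} n w → m ≡ n +ℤ w → -ℤ w ≡ n -ℤ m
m≡n+w⇒-w≡n-m n w eq = trans (identity n w) (cong (λ t → n -ℤ t) (sym eq))
  where
    identity : ∀ n w → -ℤ w ≡ n -ℤ (n +ℤ w)
    identity = solve-∀

-- The two maxima defining ε̈ᵢ and φ̈ᵢ of a tensor of bounded elements outside case (1);
-- w is the pairing of the weight of the first resp. second factor.
max-ε⊗ : ∀ {a b c} w → + b ≡ + a +ℤ w → b ≡ 0 ⊎ c ≡ 0 → + a ⊔ (+ c +ℤ -ℤ w) ≡ + (a +ℕ c)
max-ε⊗ {a} {c = c} w hw (inj₁ refl) = begin
  + a ⊔ (+ c +ℤ -ℤ w)  ≡⟨ cong (λ t → + a ⊔ (+ c +ℤ t)) (trans (m≡n+w⇒-w≡n-m (+ a) w hw) (ℤ.+-identityʳ (+ a))) ⟩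
  + a ⊔ + (c +ℕ a)     ≡⟨ ℤ.i≤j⇒i⊔j≡j (ℤ.+≤+ (ℕ.m≤n+m a c)) ⟩
  + (c +ℕ a)           ≡⟨ cong +_ (ℕ.+-comm c a) ⟩
  + (a +ℕ c)           ∎
  where open ≡-Reasoning
max-ε⊗ {a} {b} w hw (inj₂ refl) = begin
  + a ⊔ (+ 0 +ℤ -ℤ w)  ≡⟨ cong (+ a ⊔_) (trans (ℤ.+-identityˡ (-ℤ w)) (m≡n+w⇒-w≡n-m (+ a) w hw)) ⟩
  + a ⊔ (+ a -ℤ + b)   ≡⟨ ℤ.i≥j⇒i⊔j≡i (ℤ.i-j≤i (+ a) (+ b)) ⟩
  + a                  ≡⟨ cong +_ (sym (ℕ.+-identityʳ a)) ⟩
  + (a +ℕ 0)           ∎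
  where open ≡-Reasoning

max-φ⊗ : ∀ {b c d} w → + d ≡ + c +ℤ w → b ≡ 0 ⊎ c ≡ 0 → (+ b +ℤ w) ⊔ + d ≡ + (b +ℕ d)
max-φ⊗ {c = c} {d} w hw (inj₁ refl) = begin
  (+ 0 +ℤ w) ⊔ + d     ≡⟨ cong (_⊔ + d) (trans (ℤ.+-identityˡ w) (m≡n+w⇒w≡m-n (+ c) w hw)) ⟩
  (+ d -ℤ + c) ⊔ + d   ≡⟨ ℤ.i≤j⇒i⊔j≡j (ℤ.i-j≤i (+ d) (+ c)) ⟩
  + d                  ∎
  where open ≡-Reasoning
max-φ⊗ {b} {d = d} w hw (inj₂ refl) = begin
  (+ b +ℤ w) ⊔ + d     ≡⟨ cong (λ t → (+ b +ℤ t) ⊔ + d) (trans (m≡n+w⇒w≡m-n (+ 0) w hw) (ℤ.+-identityʳ (+ d))) ⟩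
  + (b +ℕ d) ⊔ + d     ≡⟨ ℤ.i≥j⇒i⊔j≡i (ℤ.+≤+ (ℕ.m≤n+m d b)) ⟩
  + (b +ℕ d)           ∎
  where open ≡-Reasoning

module _ {I : Set} (W : WeightData I) where
  open WeightData W

  IsMaxDefined⇒Step : ∀ {X} {g : X → Maybe X} {x v n} →
                      IsMaxDefined W g x v → v ≡ fin (+ n) → Step g x n
  IsMaxDefined⇒Step {g = g} {x} (k , refl , defined , maximal) refl with g x in gx
  ... | just y with s≤s _ ← maximal 1 (cong is-just gx) = step y gx
  IsMaxDefined⇒Step (zero  , refl , defined , maximal) refl | nothing = stop gx
  IsMaxDefined⇒Step (suc k , refl , defined , maximal) refl | nothing
    with () ← trans (sym defined) (cong is-just (iter-stop gx k))

  descent⇒IsMaxDefined : ∀ {X} (g : X → Maybe X) (v : X → ℤ∞) →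
    (∀ x y → g x ≡ just y → v y ≡ v x +ₑ -ℤ (+ 1)) →
    (∀ x n → v x ≡ fin (+ n) → Step g x n) →
    ∀ x n → v x ≡ fin (+ n) → IsMaxDefined W g x (v x)
  descent⇒IsMaxDefined g v lowers steps x n vx = n , vx , iterates n x vx
    where
      iterates : ∀ n x → v x ≡ fin (+ n) →
                 (is-just (iter n g x) ≡ true) × (∀ m → is-just (iter m g x) ≡ true → m ≤ℕ n)
      iterates n x vx with steps x n vx
      ... | stop g⊥ = refl , bound
        where
          bound : ∀ m → is-just (iter m g x) ≡ true → m ≤ℕ 0
          bound zero    _ = z≤n
          bound (suc m) defined with () ← trans (sym defined) (cong is-just (iter-stop g⊥ m))
      iterates (suc n) x vx | step y gy
        with iterates n y (trans (lowers x y gy) (cong (_+ₑ -ℤ (+ 1)) vx))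
      ... | defined , maximal = trans (cong is-just (iter-step gy n)) defined , λ where
              zero    _  → z≤n
              (suc m) dm → s≤s (maximal m (trans (cong is-just (sym (iter-step gy m))) dm))

  private
    weights : CommutativeSemigroup _ _
    weights = record { isCommutativeSemigroup = IsAbelianGroup.isCommutativeSemigroup isAbelianGroup }

  ⊕-shiftˡ : ∀ {u v δ} w → u ≡ v ⊕ δ → u ⊕ w ≡ (v ⊕ w) ⊕ δ
  ⊕-shiftˡ {v = v} {δ} w refl = CommutativeSemigroupProperties.xy∙z≈xz∙y weights v δ w

  ⊕-shiftʳ : ∀ {u v δ} w → u ≡ v ⊕ δ → w ⊕ u ≡ (w ⊕ v) ⊕ δ
  ⊕-shiftʳ {v = v} {δ} w refl = sym (IsAbelianGroup.assoc isAbelianGroup w v δ)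

  module _ {Q : Set} (D : QCData W Q) where
    open QCData D

    -- A product rather than a record: rewriting with the data of the factors then reduces
    -- Unbounded of a tensor element to four reflexivities.
    Unbounded : Q → I → Set
    Unbounded x i = (ε̈ i x ≡ +∞) × (φ̈ i x ≡ +∞) × (ë i x ≡ nothing) × (f̈ i x ≡ nothing)

    record Bounded (x : Q) (i : I) (a b : ℕ) : Set where
      field
        ε-fin : ε̈ i x ≡ fin (+ a)
        φ-fin : φ̈ i x ≡ fin (+ b)
        φ-wt  : + b ≡ + a +ℤ ⟨ wt x , i ∨⟩
        raise : Step (ë i) x a
        lower : Step (f̈ i) x b

    data Status (x : Q) (i : I) : Set where
      unbounded : Unbounded x i → Status x i
      bounded   : ∀ {a b} → Bounded x i a b → Status x i

  open Bounded

  module _ {Q : Set} {D : QCData W Q} (status : ∀ x i → Status D x i) where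
    open QCData D

    status⇒ax-a : ∀ x i → φ̈ i x ≡ ε̈ i x +ₑ ⟨ wt x , i ∨⟩
    status⇒ax-a x i with status x i
    ... | unbounded (ε∞ , φ∞ , _) rewrite ε∞ | φ∞ = refl
    ... | bounded B rewrite ε-fin B | φ-fin B = cong fin (φ-wt B)

    status⇒ax-e : ∀ x i → (ε̈ i x ≡ -∞ ⊎ ε̈ i x ≡ +∞) → (ë i x ≡ nothing) × (f̈ i x ≡ nothing)
    status⇒ax-e x i infinite with status x i | infinite
    ... | unbounded (_ , _ , undefined) | _ = undefined
    ... | bounded B | inj₁ ε-∞ with () ← trans (sym (ε-fin B)) ε-∞
    ... | bounded B | inj₂ ε∞  with () ← trans (sym (ε-fin B)) ε∞

    status⇒raise : ∀ x i n → ε̈ i x ≡ fin (+ n) → Step (ë i) x n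
    status⇒raise x i n εn with status x i
    ... | unbounded (ε∞ , _) with () ← trans (sym εn) ε∞
    ... | bounded B with refl ← fin-injective (trans (sym (ε-fin B)) εn) = raise B

    status⇒lower : ∀ x i n → φ̈ i x ≡ fin (+ n) → Step (f̈ i) x n
    status⇒lower x i n φn with status x i
    ... | unbounded (_ , φ∞ , _) with () ← trans (sym φn) φ∞
    ... | bounded B with refl ← fin-injective (trans (sym (φ-fin B)) φn) = lower B

    status⇒IsSeminormal : (∀ x y i → ë i x ≡ just y → ε̈ i y ≡ ε̈ i x +ₑ -ℤ (+ 1)) →
                          (∀ x y i → f̈ i x ≡ just y → φ̈ i y ≡ φ̈ i x +ₑ -ℤ (+ 1)) →
                          IsSeminormal W D
    status⇒IsSeminormal ë-lowers-ε f̈-lowers-φ = record { sn-ε = sn-ε ; sn-φ = sn-φ }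
      where
        sn-ε : ∀ x i → ¬ ε̈ i x ≡ +∞ → IsMaxDefined W (ë i) x (ε̈ i x)
        sn-ε x i ε≢∞ with status x i
        ... | unbounded (ε∞ , _) = ⊥-elim (ε≢∞ ε∞)
        ... | bounded B = descent⇒IsMaxDefined (ë i) (ε̈ i) (λ x y → ë-lowers-ε x y i)
                                                (λ x → status⇒raise x i) x _ (ε-fin B)

        sn-φ : ∀ x i → ¬ ε̈ i x ≡ +∞ → IsMaxDefined W (f̈ i) x (φ̈ i x)
        sn-φ x i ε≢∞ with status x i
        ... | unbounded (ε∞ , _) = ⊥-elim (ε≢∞ ε∞)
        ... | bounded B = descent⇒IsMaxDefined (f̈ i) (φ̈ i) (λ x y → f̈-lowers-φ x y i)
                                                (λ x → status⇒lower x i) x _ (φ-fin B)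

  module SeminormalQuasiCrystal {Q : Set} {D : QCData W Q}
           (qc : IsQuasiCrystal W D) (sn : IsSeminormal W D) where
    open QCData D
    open IsQuasiCrystal qc
    open IsSeminormal sn

    fin⇒Bounded : ∀ {x i a b} → ε̈ i x ≡ fin (+ a) → φ̈ i x ≡ fin (+ b) → Bounded D x i a b
    fin⇒Bounded {x} {i} εa φb = record
      { ε-fin = εa
      ; φ-fin = φb
      ; φ-wt  = fin-injective (trans (sym φb) (trans (ax-a x i) (cong (_+ₑ ⟨ wt x , i ∨⟩) εa)))
      ; raise = IsMaxDefined⇒Step (sn-ε x i (fin≢+∞ εa)) εa
      ; lower = IsMaxDefined⇒Step (sn-φ x i (fin≢+∞ εa)) φb
      }

    status : ∀ x i → Status D x i
    status x i with is+∞? (ε̈ i x)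
    ... | yes ε∞ = unbounded (ε∞ , trans (ax-a x i) (cong (_+ₑ ⟨ wt x , i ∨⟩) ε∞) , ax-e x i (inj₂ ε∞))
    ... | no ε≢∞ with sn-ε x i ε≢∞ | sn-φ x i ε≢∞
    ...   | _ , εa , _ | _ , φb , _ = bounded (fin⇒Bounded εa φb)

    raise-Bounded : ∀ {x y i a b} → Bounded D x i (suc a) b → ë i x ≡ just y → Bounded D y i a (suc b)
    raise-Bounded {x} {y} {i} {b = b} B ëx with ax-b x y i ëx
    ... | _ , εy , φy = fin⇒Bounded (trans εy (cong (_+ₑ -ℤ (+ 1)) (ε-fin B)))
                                    (trans φy (trans (cong (_+ₑ + 1) (φ-fin B)) (fin-suc b)))

    lower-Bounded : ∀ {x y i a b} → Bounded D x i a (suc b) → f̈ i x ≡ just y → Bounded D y i (suc a) b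
    lower-Bounded {x} {y} {i} {a} B f̈x with ax-c x y i f̈x
    ... | _ , εy , φy = fin⇒Bounded (trans εy (trans (cong (_+ₑ + 1) (ε-fin B)) (fin-suc a)))
                                    (trans φy (cong (_+ₑ -ℤ (+ 1)) (φ-fin B)))

  module Tensor {Q Q' : Set} {D : QCData W Q} {D' : QCData W Q'}
           (qc : IsQuasiCrystal W D) (sn : IsSeminormal W D)
           (qc' : IsQuasiCrystal W D') (sn' : IsSeminormal W D') where
    open QCData D
    open QCData D' renaming (wt to wt'; ë to ë'; f̈ to f̈'; ε̈ to ε̈'; φ̈ to φ̈')
    open SeminormalQuasiCrystal using (status; raise-Bounded; lower-Bounded)
    module QC  = IsQuasiCrystal qc
    module QC' = IsQuasiCrystal qc'

    T : QCData W (Q × Q')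
    T = tensor W D D'
    module T = QCData T

    record BoundedPair (x : Q) (x' : Q') (i : I) (a b c d : ℕ) : Set where
      constructor pair
      field
        left     : Bounded D x i a b
        right    : Bounded D' x' i c d
        balanced : b ≡ 0 ⊎ c ≡ 0

    not-case-1 : ∀ {x x' i a b c d} → BoundedPair x x' i a b c d →
                 (fin (+ 0) <ᵇ φ̈ i x) ∧ (fin (+ 0) <ᵇ ε̈' i x') ≡ false
    not-case-1 (pair L R (inj₁ refl)) rewrite φ-fin L = refl
    not-case-1 (pair L R (inj₂ refl)) rewrite ε-fin R = ∧-zeroʳ _

    ε⊗ : ∀ {x x' i a b c d} → BoundedPair x x' i a b c d → T.ε̈ i (x , x') ≡ fin (+ (a +ℕ c))
    ε⊗ {x} {i = i} {a} {c = c} P@(pair L R bal) rewrite not-case-1 P | ε-fin L | ε-fin R =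
      trans (max∞-fin (+ a) (+ c +ℤ -ℤ ⟨ wt x , i ∨⟩)) (cong fin (max-ε⊗ ⟨ wt x , i ∨⟩ (φ-wt L) bal))

    φ⊗ : ∀ {x x' i a b c d} → BoundedPair x x' i a b c d → T.φ̈ i (x , x') ≡ fin (+ (b +ℕ d))
    φ⊗ {x' = x'} {i} {b = b} {d = d} P@(pair L R bal) rewrite not-case-1 P | φ-fin L | φ-fin R =
      trans (max∞-fin (+ b +ℤ ⟨ wt' x' , i ∨⟩) (+ d)) (cong fin (max-φ⊗ ⟨ wt' x' , i ∨⟩ (φ-wt R) bal))

    ë⊗-left : ∀ {x x' i a b d} → BoundedPair x x' i a b 0 d →
              T.ë i (x , x') ≡ Maybe.map (_, x') (ë i x)
    ë⊗-left P@(pair L R _) rewrite not-case-1 P | φ-fin L | ε-fin R = refl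

    ë⊗-right : ∀ {x x' i a b c d} → BoundedPair x x' i a b (suc c) d →
               T.ë i (x , x') ≡ Maybe.map (x ,_) (ë' i x')
    ë⊗-right (pair L R (inj₁ refl)) rewrite φ-fin L | ε-fin R = refl

    f̈⊗-left : ∀ {x x' i a b c d} → BoundedPair x x' i a (suc b) c d →
              T.f̈ i (x , x') ≡ Maybe.map (_, x') (f̈ i x)
    f̈⊗-left (pair L R (inj₂ refl)) rewrite φ-fin L | ε-fin R = refl

    f̈⊗-right : ∀ {x x' i a c d} → BoundedPair x x' i a 0 c d →
               T.f̈ i (x , x') ≡ Maybe.map (x ,_) (f̈' i x')
    f̈⊗-right (pair L R _) rewrite φ-fin L | ε-fin R = refl

    raise⊗ : ∀ {x x' i a b c d} → BoundedPair x x' i a b c d → Step (T.ë i) (x , x') (a +ℕ c)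
    raise⊗ {c = zero} P@(pair L _ _) with raise L
    ... | stop ë⊥   = stop (trans-map (ë⊗-left P) ë⊥)
    ... | step _ ëy = step _ (trans-map (ë⊗-left P) ëy)
    raise⊗ {a = a} {c = suc c} P@(pair _ R _) with raise R
    ... | step _ ëy' rewrite ℕ.+-suc a c = step _ (trans-map (ë⊗-right P) ëy')

    lower⊗ : ∀ {x x' i a b c d} → BoundedPair x x' i a b c d → Step (T.f̈ i) (x , x') (b +ℕ d)
    lower⊗ {b = suc _} P@(pair L _ _) with lower L
    ... | step _ f̈y = step _ (trans-map (f̈⊗-left P) f̈y)
    lower⊗ {b = zero} P@(pair _ R _) with lower R
    ... | stop f̈⊥     = stop (trans-map (f̈⊗-right P) f̈⊥)
    ... | step _ f̈y' = step _ (trans-map (f̈⊗-right P) f̈y')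

    bounded⊗ : ∀ {x x' i a b c d} → BoundedPair x x' i a b c d → Bounded T (x , x') i (a +ℕ c) (b +ℕ d)
    bounded⊗ {x} {x'} {i} {a} {b} {c} {d} P@(pair L R _) = record
      { ε-fin = ε⊗ P
      ; φ-fin = φ⊗ P
      ; φ-wt  = begin
          + b +ℤ + d                   ≡⟨ cong₂ _+ℤ_ (φ-wt L) (φ-wt R) ⟩
          (+ a +ℤ w) +ℤ (+ c +ℤ w')    ≡⟨ interchange (+ a) w (+ c) w' ⟩
          (+ a +ℤ + c) +ℤ (w +ℤ w')    ≡⟨ cong (+ (a +ℕ c) +ℤ_) (sym (pairing-+ (wt x) (wt' x') i)) ⟩
          + (a +ℕ c) +ℤ ⟨ wt x ⊕ wt' x' , i ∨⟩ ∎
      ; raise = raise⊗ P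
      ; lower = lower⊗ P
      }
      where
        open ≡-Reasoning
        w w' : ℤ
        w  = ⟨ wt x , i ∨⟩
        w' = ⟨ wt' x' , i ∨⟩
        interchange : ∀ m w n w' → (m +ℤ w) +ℤ (n +ℤ w') ≡ (m +ℤ n) +ℤ (w +ℤ w')
        interchange = solve-∀

    case-1⇒unbounded : ∀ {x x' i} → fin (+ 0) <ᵇ φ̈ i x ≡ true → fin (+ 0) <ᵇ ε̈' i x' ≡ true →
                       Unbounded T (x , x') i
    case-1⇒unbounded φ>0 ε'>0 rewrite φ>0 | ε'>0 = refl , refl , refl , refl

    unbounded⊗ˡ : ∀ {x x' i d} → Unbounded D x i → Bounded D' x' i 0 d → Unbounded T (x , x') i
    unbounded⊗ˡ (ε∞ , φ∞ , ë⊥ , f̈⊥) R rewrite ε∞ | φ∞ | ë⊥ | f̈⊥ | ε-fin R | φ-fin R =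
      refl , refl , refl , refl

    unbounded⊗ʳ : ∀ {x x' i a} → Bounded D x i a 0 → Unbounded D' x' i → Unbounded T (x , x') i
    unbounded⊗ʳ L (ε∞ , φ∞ , ë⊥ , f̈⊥) rewrite ε-fin L | φ-fin L | ε∞ | φ∞ | ë⊥ | f̈⊥ =
      refl , refl , refl , refl

    data PairStatus (x : Q) (x' : Q') (i : I) : Set where
      unbounded : Unbounded T (x , x') i → PairStatus x x' i
      bounded   : ∀ {a b c d} → BoundedPair x x' i a b c d → PairStatus x x' i

    private
      positive-+∞ : ∀ {v} → v ≡ +∞ → fin (+ 0) <ᵇ v ≡ true
      positive-+∞ refl = refl

      positive-suc : ∀ {v n} → v ≡ fin (+ suc n) → fin (+ 0) <ᵇ v ≡ true
      positive-suc refl = refl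

    pair-status : ∀ x x' i → PairStatus x x' i
    pair-status x x' i with status qc sn x i | status qc' sn' x' i
    ... | unbounded (_ , φ∞ , _) | unbounded (ε∞' , _) =
          unbounded (case-1⇒unbounded (positive-+∞ φ∞) (positive-+∞ ε∞'))
    ... | unbounded U | bounded {a = zero} R = unbounded (unbounded⊗ˡ U R)
    ... | unbounded (_ , φ∞ , _) | bounded {a = suc _} R =
          unbounded (case-1⇒unbounded (positive-+∞ φ∞) (positive-suc (ε-fin R)))
    ... | bounded {b = zero} L | unbounded U' = unbounded (unbounded⊗ʳ L U')
    ... | bounded {b = suc _} L | unbounded (ε∞' , _) =
          unbounded (case-1⇒unbounded (positive-suc (φ-fin L)) (positive-+∞ ε∞'))
    ... | bounded {b = suc _} L | bounded {a = suc _} R =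
          unbounded (case-1⇒unbounded (positive-suc (φ-fin L)) (positive-suc (ε-fin R)))
    ... | bounded {b = zero} L | bounded R = bounded (pair L R (inj₁ refl))
    ... | bounded L | bounded {a = zero} R = bounded (pair L R (inj₂ refl))

    status⊗ : ∀ p i → Status T p i
    status⊗ (x , x') i with pair-status x x' i
    ... | unbounded U = unbounded U
    ... | bounded P   = bounded (bounded⊗ P)

    data Raised (x : Q) (x' : Q') (i : I) : ℕ → ℕ → ℕ → ℕ → Q × Q' → Set where
      raised-left  : ∀ {y a b d} → ë i x ≡ just y → BoundedPair y x' i a (suc b) 0 d →
                     Raised x x' i (suc a) b 0 d (y , x')
      raised-right : ∀ {y' a c d} → ë' i x' ≡ just y' → BoundedPair x y' i a 0 c (suc d) →
                     Raised x x' i a 0 (suc c) d (x , y')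

    data Lowered (x : Q) (x' : Q') (i : I) : ℕ → ℕ → ℕ → ℕ → Q × Q' → Set where
      lowered-left  : ∀ {y a b d} → f̈ i x ≡ just y → BoundedPair y x' i (suc a) b 0 d →
                      Lowered x x' i a (suc b) 0 d (y , x')
      lowered-right : ∀ {y' a c d} → f̈' i x' ≡ just y' → BoundedPair x y' i a 0 (suc c) d →
                      Lowered x x' i a 0 c (suc d) (x , y')

    raised : ∀ {x x' i a b c d q} → BoundedPair x x' i a b c d → T.ë i (x , x') ≡ just q →
             Raised x x' i a b c d q
    raised {c = zero} P@(pair L R _) e with raise L
    ... | stop ë⊥ with () ← trans (sym e) (trans-map (ë⊗-left P) ë⊥)
    ... | step y ëy with refl ← just-injective (trans (sym e) (trans-map (ë⊗-left P) ëy)) =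
      raised-left ëy (pair (raise-Bounded qc sn L ëy) R (inj₂ refl))
    raised {c = suc _} P@(pair L R (inj₁ refl)) e with raise R
    ... | step y' ëy' with refl ← just-injective (trans (sym e) (trans-map (ë⊗-right P) ëy')) =
      raised-right ëy' (pair L (raise-Bounded qc' sn' R ëy') (inj₁ refl))

    lowered : ∀ {x x' i a b c d q} → BoundedPair x x' i a b c d → T.f̈ i (x , x') ≡ just q →
              Lowered x x' i a b c d q
    lowered {b = suc _} P@(pair L R (inj₂ refl)) e with lower L
    ... | step y f̈y with refl ← just-injective (trans (sym e) (trans-map (f̈⊗-left P) f̈y)) =
      lowered-left f̈y (pair (lower-Bounded qc sn L f̈y) R (inj₂ refl))
    lowered {b = zero} P@(pair L R _) e with lower R
    ... | stop f̈⊥ with () ← trans (sym e) (trans-map (f̈⊗-right P) f̈⊥)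
    ... | step y' f̈y' with refl ← just-injective (trans (sym e) (trans-map (f̈⊗-right P) f̈y')) =
      lowered-right f̈y' (pair L (lower-Bounded qc' sn' R f̈y') (inj₁ refl))

    ax-b⊗ : ∀ p q i → T.ë i p ≡ just q →
            (T.wt q ≡ T.wt p ⊕ α i) × (T.ε̈ i q ≡ T.ε̈ i p +ₑ -ℤ (+ 1)) × (T.φ̈ i q ≡ T.φ̈ i p +ₑ + 1)
    ax-b⊗ (x , x') q i e with pair-status x x' i
    ... | unbounded (_ , _ , ë⊥ , _) with () ← trans (sym e) ë⊥
    ... | bounded P with raised P e
    ...   | raised-left {y} ëy P' =
            ⊕-shiftˡ (wt' x') (proj₁ (QC.ax-b x y i ëy))
          , pred-fin (ε⊗ P) refl (ε⊗ P') , suc-fin (φ⊗ P) refl (φ⊗ P')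
    ...   | raised-right {y'} {a} {c} ëy' P' =
            ⊕-shiftʳ (wt x) (proj₁ (QC'.ax-b x' y' i ëy'))
          , pred-fin (ε⊗ P) (ℕ.+-suc a c) (ε⊗ P') , suc-fin (φ⊗ P) refl (φ⊗ P')

    ax-c⊗ : ∀ p q i → T.f̈ i p ≡ just q →
            (T.wt q ≡ T.wt p ⊕ (⊖ α i)) × (T.ε̈ i q ≡ T.ε̈ i p +ₑ + 1) × (T.φ̈ i q ≡ T.φ̈ i p +ₑ -ℤ (+ 1))
    ax-c⊗ (x , x') q i e with pair-status x x' i
    ... | unbounded (_ , _ , _ , f̈⊥) with () ← trans (sym e) f̈⊥
    ... | bounded P with lowered P e
    ...   | lowered-left {y} f̈y P' =
            ⊕-shiftˡ (wt' x') (proj₁ (QC.ax-c x y i f̈y))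
          , suc-fin (ε⊗ P) refl (ε⊗ P') , pred-fin (φ⊗ P) refl (φ⊗ P')
    ...   | lowered-right {y'} {a} {c} f̈y' P' =
            ⊕-shiftʳ (wt x) (proj₁ (QC'.ax-c x' y' i f̈y'))
          , suc-fin (ε⊗ P) (ℕ.+-suc a c) (ε⊗ P') , pred-fin (φ⊗ P) refl (φ⊗ P')

    ax-d-⇒⊗ : ∀ p q i → T.ë i p ≡ just q → T.f̈ i q ≡ just p
    ax-d-⇒⊗ (x , x') q i e with pair-status x x' i
    ... | unbounded (_ , _ , ë⊥ , _) with () ← trans (sym e) ë⊥
    ... | bounded P with raised P e
    ...   | raised-left {y} ëy P' = trans-map (f̈⊗-left P') (QC.ax-d-⇒ x y i ëy)
    ...   | raised-right {y'} ëy' P' = trans-map (f̈⊗-right P') (QC'.ax-d-⇒ x' y' i ëy')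

    ax-d-⇐⊗ : ∀ p q i → T.f̈ i q ≡ just p → T.ë i p ≡ just q
    ax-d-⇐⊗ p (x , x') i e with pair-status x x' i
    ... | unbounded (_ , _ , _ , f̈⊥) with () ← trans (sym e) f̈⊥
    ... | bounded P with lowered P e
    ...   | lowered-left {y} f̈y P' = trans-map (ë⊗-left P') (QC.ax-d-⇐ y x i f̈y)
    ...   | lowered-right {y'} f̈y' P' = trans-map (ë⊗-right P') (QC'.ax-d-⇐ y' x' i f̈y')

theorem5p1 : {I : Set} (W : WeightData I) {Q Q' : Set}
    (D : QCData W Q) (D' : QCData W Q') →
    IsQuasiCrystal W D → IsSeminormal W D →
    IsQuasiCrystal W D' → IsSeminormal W D' →
    IsQuasiCrystal W (tensor W D D') × IsSeminormal W (tensor W D D')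
theorem5p1 W D D' qc sn qc' sn' =
    record
      { ax-a   = status⇒ax-a W status⊗
      ; ax-b   = ax-b⊗
      ; ax-c   = ax-c⊗
      ; ax-d-⇒ = ax-d-⇒⊗
      ; ax-d-⇐ = ax-d-⇐⊗
      ; ax-e   = status⇒ax-e W status⊗
      }
  , status⇒IsSeminormal W status⊗ (λ p q i e → proj₁ (proj₂ (ax-b⊗ p q i e)))
                                  (λ p q i e → proj₂ (proj₂ (ax-c⊗ p q i e)))
  where open Tensor W qc sn qc' sn'
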